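{- Let $H$ be a graph with $r$ vertices and $q$ a positive integer. Let $\mathcal{H}$ be the $r$-uniform hypergraph on vertex set $V(H(q))$ whose edges are the vertex sets of the standard copies of $H$ in the $q$-bookpile $H(q)$. Then $\mathcal{H}$ is isomorphic to $\mathcal{H}_q^r$.
   Context: For a graph $F$, an independent set $I\subseteq V(F)$ and a positive integer $q$, the $q$-book $F_I^q$ is obtained by taking $q$ vertex-disjoint copies of $F$ and identifying, for each $x\in I$, the $q$ copies of $x$. Let $V(H)=\{v_1,\dots,v_r\}$. Define graphs $H_0,\dots,H_r$ whose vertices carry a type in $V(H)$: $H_0=H$ with $v_j$ of type $v_j$; for $1\le i\le r$, $H_i=(H_{i-1})^q_{U_i}$ where $U_i$ is the (independent) set of vertices of type $v_i$ in $H_{i-1}$, types being inherited by copies. The $q$-bookpile is $H(q):=H_r$. Standard copies: $H_0$ has a single standard copy of $H$, namely itself; the standard copies of $H$ in $H_i$ are the images of the standard copies of $H$ in $H_{i-1}$ inside each of the $q$ copies of $H_{i-1}$ used to build $H_i$. Thus $H(q)$ decomposes into $q^r$ edge-disjoint standard copies of $H$. Let $[q]=\{1,\dots,q\}$ and $\alpha$ a symbol not in $[q]$. Let $V(q,r,\alpha)$ be the set of $r$-tuples $(n_1,\dots,n_r)$ in which exactly one entry equals $\alpha$ and all other entries lie in $[q]$. $\mathcal{H}_q^r$ is the $r$-uniform hypergraph on $V(q,r,\alpha)$ with edge set indexed by $[q]^r$, where the edge $e\in[q]^r$ consists of the $r$ vertices obtained from $e$ by replacing exactly one of its entries by $\alpha$.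 -}

module Defs where

open import Data.Nat using (ℕ; zero; suc)
open import Data.Fin using (Fin; _≟_)
open import Data.Vec using (Vec; []; _∷_; _[_]≔_; map)
open import Data.List using (List; foldl; allFin)
open import Data.Unit using (⊤; tt)
open import Data.Product using (Σ; ∃; _×_; _,_; proj₁)
open import Relation.Nullary using (¬_; Dec; yes; no)
open import Relation.Binary.PropositionalEquality using (_≡_)
open import Function.Bundles using (_↔_; _⇔_; Inverse)

-- A (simple) graph H on the vertex set Fin r = {v_1,...,v_r} (v_j = j, in the order of Fin r).
record Graph (r : ℕ) : Set₁ where
  field
    Adj    : Fin r → Fin r → Set
    sym    : ∀ {x y} → Adj x y → Adj y x
    irrefl : ∀ {x} → ¬ Adj x x

-- A graph whose vertices carry a type in V(H) = Fin r, together with its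
-- family of standard copies of H (indexed by Idx; copy c maps v_j to the
-- vertex of that copy corresponding to v_j).
record TGraph (r : ℕ) : Set₁ where
  field
    V    : Set
    Adj  : V → V → Set
    type : V → Fin r
    Idx  : Set
    copy : Idx → Fin r → V

-- Second component of a vertex of a q-book: identified vertices (type = i)
-- exist once, the others once per copy.
Slot : ∀ {A : Set} → ℕ → Dec A → Set
Slot q (yes _) = ⊤
Slot q (no _)  = Fin q

pick : ∀ {A : Set} {q : ℕ} (d : Dec A) → Fin q → Slot q d
pick (yes _) k = tt
pick (no _)  k = k

module _ {r : ℕ} (q : ℕ) (i : Fin r) (G : TGraph r) where
  open TGraph G

  -- vertex set of the q-book G^q_{U_i}, U_i = vertices of type v_i
  -- (q disjoint copies of G with the copies of each x ∈ U_i identified)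
  BookV : Set
  BookV = Σ V (λ v → Slot q (type v ≟ i))

  inj : Fin q → V → BookV
  inj k v = v , pick (type v ≟ i) k

  book : TGraph r
  book = record
    { V    = BookV
    ; Adj  = λ a b → Σ (Fin q) λ k → Σ V λ x → Σ V λ y →
               Adj x y × (inj k x ≡ a) × (inj k y ≡ b)
    ; type = λ a → type (proj₁ a)
    ; Idx  = Idx × Fin q
    ; copy = λ { (c , k) j → inj k (copy c j) }
    }

H₀ : ∀ {r} → Graph r → TGraph r
H₀ {r} H = record
  { V = Fin r ; Adj = Graph.Adj H ; type = λ v → v ; Idx = ⊤ ; copy = λ _ j → j }

bookpile : ∀ {r} → Graph r → ℕ → TGraph r
bookpile {r} H q = foldl (λ G i → book q i G) (H₀ H) (allFin r)

-- Hypergraph: vertex type, edge index type, incidence.  An edge is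
-- identified with its vertex set {x | x ∈ₑ e}.
record Hypergraph : Set₁ where
  field
    V    : Set
    E    : Set
    _∈ₑ_ : V → E → Set

copyHypergraph : ∀ {r} → Graph r → ℕ → Hypergraph
copyHypergraph H q = record
  { V = TGraph.V G ; E = TGraph.Idx G
  ; _∈ₑ_ = λ x c → ∃ λ j → TGraph.copy G c j ≡ x }
  where G = bookpile H q

data Entry (q : ℕ) : Set where
  num : Fin q → Entry q
  α   : Entry q

countα : ∀ {q n} → Vec (Entry q) n → ℕ
countα []          = zero
countα (num _ ∷ v) = countα v
countα (α ∷ v)     = suc (countα v)

Vqrα : ℕ → ℕ → Set
Vqrα q r = Σ (Vec (Entry q) r) (λ n → countα n ≡ 1)

𝓗 : ℕ → ℕ → Hypergraph
𝓗 q r = record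
  { V = Vqrα q r ; E = Vec (Fin q) r
  ; _∈ₑ_ = λ x e → ∃ λ j → proj₁ x ≡ (map num e [ j ]≔ α) }

record _≅_ (A B : Hypergraph) : Set where
  module A = Hypergraph A
  module B = Hypergraph B
  field
    φ   : A.V ↔ B.V
    fwd : ∀ (e : A.E) → ∃ λ (e' : B.E) →
            ∀ x → (A._∈ₑ_ x e ⇔ B._∈ₑ_ (Inverse.to φ x) e')
    bwd : ∀ (e' : B.E) → ∃ λ (e : A.E) →
            ∀ x → (A._∈ₑ_ x e ⇔ B._∈ₑ_ (Inverse.to φ x) e')

-- Give every vertex of the bookpile a tuple in V(q,r,α): α at its own type and, at each other type i,
-- the page of the i-th book on which it lies.  A standard copy is labelled by the pages (k₁,…,k_r) it
-- was copied onto, and its vertex of type j gets the label with the j-th entry replaced by α; so the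
-- vertex set of the copy labelled e is exactly the edge e of 𝓗_q^r.  Both labellings are bijective,
-- which is proved by induction along the books: each book over U_i adds the i-th coordinate, and
-- vertices of type i, shared by all pages, keep α there.
module Submission where

open import Defs
open import Data.Nat using (ℕ; _≤_; s≤s)
open import Data.Nat.Properties using (≡-irrelevant; suc-injective)
open import Data.Fin using (Fin; zero; suc; _≟_)
open import Data.Fin.Subset using (Subset; Side; inside; outside; ⊥; ⊤)
open import Data.Vec using (Vec; []; _∷_; _[_]≔_; lookup; map; replicate; zipWith)
open import Data.Vec.Properties
  using ( lookup∘update; lookup∘update′; lookup-replicate; lookup-zipWith
        ; []≔-lookup; []≔-idempotent; []≔-commutes; map-[]≔ )
open import Data.Vec.Relation.Binary.Pointwise.Extensional using (ext; Pointwise-≡⇒≡)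
open import Data.List using (List; []; _∷_; foldl; allFin)
open import Data.List.Relation.Unary.All as All using (All; _∷_)
open import Data.List.Relation.Unary.AllPairs using (_∷_)
open import Data.List.Relation.Unary.Any using (here; there)
open import Data.List.Relation.Unary.Unique.Propositional using (Unique)
open import Data.List.Relation.Unary.Unique.Propositional.Properties using (allFin⁺)
open import Data.List.Membership.Propositional using (_∈_)
open import Data.List.Membership.Propositional.Properties using (∈-allFin)
open import Data.Unit using (tt)
open import Data.Empty using (⊥-elim)
open import Data.Product using (∃; _,_; proj₁)
open import Relation.Nullary using (Dec; yes; no)
open import Relation.Binary.PropositionalEquality
  using (_≡_; _≢_; refl; sym; trans; cong; cong₂; subst; ≢-sym; module ≡-Reasoning)
open import Function.Bundles using (_⇔_; mk⇔; mk↔ₛ′)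

private
  variable
    A B C : Set
    n q r : ℕ

zipWith-[]≔ˡ : ∀ (f : A → B → C) (xs : Vec A n) ys i x →
               zipWith f (xs [ i ]≔ x) ys ≡ zipWith f xs ys [ i ]≔ f x (lookup ys i)
zipWith-[]≔ˡ f (_ ∷ xs) (_ ∷ ys) zero    x = refl
zipWith-[]≔ˡ f (x′ ∷ xs) (y′ ∷ ys) (suc i) x = cong (f x′ y′ ∷_) (zipWith-[]≔ˡ f xs ys i x)

zipWith-[]≔ʳ-irrelevant : ∀ (f : A → B → C) (xs : Vec A n) ys i y →
                          f (lookup xs i) y ≡ f (lookup xs i) (lookup ys i) →
                          zipWith f xs (ys [ i ]≔ y) ≡ zipWith f xs ys
zipWith-[]≔ʳ-irrelevant f (_ ∷ xs) (_ ∷ ys) zero    y eq = cong (_∷ zipWith f xs ys) eq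
zipWith-[]≔ʳ-irrelevant f (x′ ∷ xs) (y′ ∷ ys) (suc i) y eq =
  cong (f x′ y′ ∷_) (zipWith-[]≔ʳ-irrelevant f xs ys i y eq)

Vqrα-≡ : {v w : Vqrα q r} → proj₁ v ≡ proj₁ w → v ≡ w
Vqrα-≡ {v = v , p} {w = .v , p′} refl = cong (v ,_) (≡-irrelevant p p′)

countα-map-num : (e : Vec (Fin q) n) → countα (map num e) ≡ 0
countα-map-num []      = refl
countα-map-num (_ ∷ e) = countα-map-num e

countα-map-num-[]≔α : (e : Vec (Fin q) n) (j : Fin n) → countα (map num e [ j ]≔ α) ≡ 1
countα-map-num-[]≔α (_ ∷ e) zero    = cong ℕ.suc (countα-map-num e)
countα-map-num-[]≔α (_ ∷ e) (suc j) = countα-map-num-[]≔α e j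

countα≡0⇒α∉ : (v : Vec (Entry q) n) → countα v ≡ 0 → ∀ j → lookup v j ≢ α
countα≡0⇒α∉ (num _ ∷ v) c (suc j) = countα≡0⇒α∉ v c j

α-unique : (v : Vec (Entry q) n) → countα v ≡ 1 →
           ∀ {i j} → lookup v i ≡ α → lookup v j ≡ α → i ≡ j
α-unique (num _ ∷ v) c {suc i} {suc j} vᵢ vⱼ = cong suc (α-unique v c vᵢ vⱼ)
α-unique (α ∷ v)     c {zero}  {zero}  vᵢ vⱼ = refl
α-unique (α ∷ v)     c {zero}  {suc j} vᵢ vⱼ = ⊥-elim (countα≡0⇒α∉ v (suc-injective c) j vⱼ)
α-unique (α ∷ v)     c {suc i} {j}     vᵢ vⱼ = ⊥-elim (countα≡0⇒α∉ v (suc-injective c) i vᵢ)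

countα-[]≔-num : (v : Vec (Entry q) n) → ∀ i k → lookup v i ≢ α →
                 countα (v [ i ]≔ num k) ≡ countα v
countα-[]≔-num (num _ ∷ v) zero    k vᵢ≢α = refl
countα-[]≔-num (α ∷ v)     zero    k vᵢ≢α = ⊥-elim (vᵢ≢α refl)
countα-[]≔-num (num _ ∷ v) (suc i) k vᵢ≢α = countα-[]≔-num v i k vᵢ≢α
countα-[]≔-num (α ∷ v)     (suc i) k vᵢ≢α = cong ℕ.suc (countα-[]≔-num v i k vᵢ≢α)

αIndex : (v : Vec (Entry q) n) → countα v ≡ 1 → Fin n
αIndex (num _ ∷ v) c = suc (αIndex v c)
αIndex (α ∷ v)     c = zero

lookup-αIndex : (v : Vec (Entry q) n) (c : countα v ≡ 1) → lookup v (αIndex v c) ≡ α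
lookup-αIndex (num _ ∷ v) c = lookup-αIndex v c
lookup-αIndex (α ∷ v)     c = refl

standardCopies : TGraph r → Hypergraph
standardCopies G = record
  { V = TGraph.V G ; E = TGraph.Idx G
  ; _∈ₑ_ = λ x c → ∃ λ j → TGraph.copy G c j ≡ x }

insertAll : Subset n → List (Fin n) → Subset n
insertAll = foldl (λ D i → D [ i ]≔ inside)

insertAll-mono : ∀ (D : Subset n) xs {x} → lookup D x ≡ inside →
                 lookup (insertAll D xs) x ≡ inside
insertAll-mono D []       Dₓ = Dₓ
insertAll-mono D (y ∷ xs) {x} Dₓ = insertAll-mono (D [ y ]≔ inside) xs (inserted (x ≟ y))
  where
  inserted : Dec (x ≡ y) → lookup (D [ y ]≔ inside) x ≡ inside
  inserted (yes refl) = lookup∘update x D inside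
  inserted (no x≢y)   = trans (lookup∘update′ x≢y D inside) Dₓ

insertAll-∈ : ∀ (D : Subset n) {xs x} → x ∈ xs → lookup (insertAll D xs) x ≡ inside
insertAll-∈ D {x ∷ xs} (here refl) = insertAll-mono (D [ x ]≔ inside) xs (lookup∘update x D inside)
insertAll-∈ D {y ∷ xs} (there x∈xs) = insertAll-∈ (D [ y ]≔ inside) x∈xs

insertAll-allFin : (D : Subset n) → insertAll D (allFin n) ≡ ⊤
insertAll-allFin D = Pointwise-≡⇒≡ (ext λ j →
  trans (insertAll-∈ D (∈-allFin j)) (sym (lookup-replicate j inside)))

module _ (o : Fin q) where

  forget : Side → Fin q → Fin q
  forget inside  k = k
  forget outside _ = o

  forgetₑ : Side → Entry q → Entry q
  forgetₑ inside  e       = e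
  forgetₑ outside (num _) = num o
  forgetₑ outside α       = α

  restrict : Subset n → Vec (Fin q) n → Vec (Fin q) n
  restrict = zipWith forget

  restrictₑ : Subset n → Vec (Entry q) n → Vec (Entry q) n
  restrictₑ = zipWith forgetₑ

  -- The junk value at α is only ever discarded by pick, on the vertices of type i.
  value : Entry q → Fin q
  value (num k) = k
  value α       = o

  num-value : ∀ {e} → e ≢ α → num (value e) ≡ e
  num-value {e = num k} _   = refl
  num-value {e = α}     e≢α = ⊥-elim (e≢α refl)

  restrictₑ-α : ∀ (D : Subset n) v j → lookup (restrictₑ D v) j ≡ α → lookup v j ≡ α
  restrictₑ-α D v j eq =
    reflect (lookup D j) (lookup v j) (trans (sym (lookup-zipWith forgetₑ j D v)) eq)
    where
    reflect : ∀ s e → forgetₑ s e ≡ α → e ≡ α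
    reflect inside  e eq = eq
    reflect outside α eq = refl

  restrict-[]≔-outside : ∀ (D : Subset n) e {i} k → lookup D i ≡ outside →
                         restrict D (e [ i ]≔ k) ≡ restrict D e
  restrict-[]≔-outside D e {i} k Dᵢ = zipWith-[]≔ʳ-irrelevant forget D e i k (invisible Dᵢ)
    where
    invisible : ∀ {s} → s ≡ outside → forget s k ≡ forget s (lookup e i)
    invisible refl = refl

  restrictₑ-[]≔-outside : ∀ (D : Subset n) v {i} k → lookup D i ≡ outside → lookup v i ≢ α →
                          restrictₑ D (v [ i ]≔ num k) ≡ restrictₑ D v
  restrictₑ-[]≔-outside D v {i} k Dᵢ vᵢ≢α =
    zipWith-[]≔ʳ-irrelevant forgetₑ D v i (num k) (invisible Dᵢ)
    where
    invisible : ∀ {s} → s ≡ outside → forgetₑ s (num k) ≡ forgetₑ s (lookup v i)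
    invisible refl with lookup v i
    ... | num _ = refl
    ... | α     = ⊥-elim (vᵢ≢α refl)

  restrict-⊤ : (e : Vec (Fin q) n) → restrict ⊤ e ≡ e
  restrict-⊤ []      = refl
  restrict-⊤ (k ∷ e) = cong (k ∷_) (restrict-⊤ e)

  restrictₑ-⊤ : (v : Vec (Entry q) n) → restrictₑ ⊤ v ≡ v
  restrictₑ-⊤ []      = refl
  restrictₑ-⊤ (x ∷ v) = cong (x ∷_) (restrictₑ-⊤ v)

  restrict-⊥ : (e : Vec (Fin q) n) → restrict ⊥ e ≡ replicate n o
  restrict-⊥ []      = refl
  restrict-⊥ (_ ∷ e) = cong (o ∷_) (restrict-⊥ e)

  restrictₑ-⊥-α∉ : (v : Vec (Entry q) n) → countα v ≡ 0 →
                   restrictₑ ⊥ v ≡ map num (replicate n o)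
  restrictₑ-⊥-α∉ []          c = refl
  restrictₑ-⊥-α∉ (num _ ∷ v) c = cong (num o ∷_) (restrictₑ-⊥-α∉ v c)

  restrictₑ-⊥ : (v : Vec (Entry q) n) (c : countα v ≡ 1) →
                restrictₑ ⊥ v ≡ map num (replicate n o) [ αIndex v c ]≔ α
  restrictₑ-⊥ (num _ ∷ v) c = cong (num o ∷_) (restrictₑ-⊥ v c)
  restrictₑ-⊥ (α ∷ v)     c = cong (α ∷_) (restrictₑ-⊥-α∉ v (suc-injective c))

  -- Coordinates after the books over the types in D: entries at types outside D are not yet
  -- assigned and are normalised to o.
  record Coordinates (D : Subset r) (G : TGraph r) : Set where
    open TGraph G
    field
      coord          : V → Vec (Entry q) r
      coord-countα   : ∀ x → countα (coord x) ≡ 1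
      coord-type     : ∀ x → lookup (coord x) (type x) ≡ α
      vertexAt       : Vqrα q r → V
      vertexAt-coord : ∀ x → vertexAt (coord x , coord-countα x) ≡ x
      coord-vertexAt : ∀ w → coord (vertexAt w) ≡ restrictₑ D (proj₁ w)
      label          : Idx → Vec (Fin q) r
      copyAt         : Vec (Fin q) r → Idx
      copyAt-label   : ∀ c → copyAt (label c) ≡ c
      label-copyAt   : ∀ e → label (copyAt e) ≡ restrict D e
      coord-copy     : ∀ c j → coord (copy c j) ≡ map num (label c) [ j ]≔ α

    vertexAt-coord′ : ∀ x {c} → vertexAt (coord x , c) ≡ x
    vertexAt-coord′ x = trans (cong vertexAt (Vqrα-≡ refl)) (vertexAt-coord x)

    coord-injective : ∀ {x y} → coord x ≡ coord y → x ≡ y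
    coord-injective {x} {y} eq = begin
      x                                   ≡⟨ sym (vertexAt-coord x) ⟩
      vertexAt (coord x , coord-countα x) ≡⟨ cong vertexAt (Vqrα-≡ eq) ⟩
      vertexAt (coord y , coord-countα y) ≡⟨ vertexAt-coord y ⟩
      y                                   ∎
      where open ≡-Reasoning

    label-injective : ∀ {c d} → label c ≡ label d → c ≡ d
    label-injective {c} {d} eq =
      trans (sym (copyAt-label c)) (trans (cong copyAt eq) (copyAt-label d))

    vertexAt-restrictₑ : ∀ {v w} → restrictₑ D (proj₁ v) ≡ restrictₑ D (proj₁ w) →
                         vertexAt v ≡ vertexAt w
    vertexAt-restrictₑ {v} {w} eq =
      coord-injective (trans (coord-vertexAt v) (trans eq (sym (coord-vertexAt w))))

    copyAt-restrict : ∀ {e e′} → restrict D e ≡ restrict D e′ → copyAt e ≡ copyAt e′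
    copyAt-restrict {e} {e′} eq =
      label-injective (trans (label-copyAt e) (trans eq (sym (label-copyAt e′))))

    coord-α⇒type : ∀ x {j} → lookup (coord x) j ≡ α → j ≡ type x
    coord-α⇒type x xⱼ = α-unique (coord x) (coord-countα x) xⱼ (coord-type x)

    vertexAt-type : ∀ w → lookup (proj₁ w) (type (vertexAt w)) ≡ α
    vertexAt-type (w , c) = restrictₑ-α D w t
      (subst (λ u → lookup u t ≡ α) (coord-vertexAt (w , c)) (coord-type x))
      where
      x = vertexAt (w , c)
      t = type x

    type-copy : ∀ c j → type (copy c j) ≡ j
    type-copy c j = sym (coord-α⇒type (copy c j)
      (trans (cong (λ u → lookup u j) (coord-copy c j)) (lookup∘update j (map num (label c)) α)))

  module BookStep {D : Subset r} {G : TGraph r}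
                  (i : Fin r) (C : Coordinates D G) (Dᵢ : lookup D i ≡ outside) where
    open TGraph G
    open Coordinates C

    coordᵢ≢α : ∀ x → type x ≢ i → lookup (coord x) i ≢ α
    coordᵢ≢α x t≢i xᵢ = t≢i (sym (coord-α⇒type x xᵢ))

    coordSlot : ∀ x (d : Dec (type x ≡ i)) → Slot q d → Vec (Entry q) r
    coordSlot x (yes _) _ = coord x
    coordSlot x (no _)  k = coord x [ i ]≔ num k

    coordSlot-countα : ∀ x d s → countα (coordSlot x d s) ≡ 1
    coordSlot-countα x (yes _) _ = coord-countα x
    coordSlot-countα x (no t≢i) k =
      trans (countα-[]≔-num (coord x) i k (coordᵢ≢α x t≢i)) (coord-countα x)

    coordSlot-type : ∀ x d s → lookup (coordSlot x d s) (type x) ≡ α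
    coordSlot-type x (yes _)  _ = coord-type x
    coordSlot-type x (no t≢i) k = trans (lookup∘update′ t≢i (coord x) (num k)) (coord-type x)

    vertexAt-coordSlot : ∀ x d s {c} → vertexAt (coordSlot x d s , c) ≡ x
    vertexAt-coordSlot x (yes _)  _ = vertexAt-coord′ x
    vertexAt-coordSlot x (no t≢i) k {c} = trans
      (vertexAt-restrictₑ {v = _ , c} {w = coord x , coord-countα x}
        (restrictₑ-[]≔-outside D (coord x) k Dᵢ (coordᵢ≢α x t≢i)))
      (vertexAt-coord x)

    pick-coordSlot : ∀ x d s → pick d (value (lookup (coordSlot x d s) i)) ≡ s
    pick-coordSlot x (yes _) _ = refl
    pick-coordSlot x (no _)  k = cong value (lookup∘update i (coord x) (num k))

    coordSlot-pick : ∀ w x (d : Dec (type x ≡ i)) → x ≡ vertexAt w →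
                     coordSlot x d (pick d (value (lookup (proj₁ w) i)))
                       ≡ restrictₑ D (proj₁ w) [ i ]≔ lookup (proj₁ w) i
    coordSlot-pick w x (yes t≡i) refl = begin
      coord x                                         ≡⟨ sym ([]≔-lookup (coord x) i) ⟩
      coord x [ i ]≔ lookup (coord x) i               ≡⟨ cong₂ _[ i ]≔_ (coord-vertexAt w) (trans xᵢ (sym wᵢ)) ⟩
      restrictₑ D (proj₁ w) [ i ]≔ lookup (proj₁ w) i ∎
      where
      open ≡-Reasoning
      xᵢ = subst (λ j → lookup (coord x) j ≡ α) t≡i (coord-type x)
      wᵢ = subst (λ j → lookup (proj₁ w) j ≡ α) t≡i (vertexAt-type w)
    coordSlot-pick (w , c) x (no t≢i) refl = cong₂ _[ i ]≔_ (coord-vertexAt (w , c))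
      (num-value (λ wᵢ → t≢i (sym (α-unique w c wᵢ (vertexAt-type (w , c))))))

    coordSlot-copy : ∀ c k j (d : Dec (type (copy c j) ≡ i)) →
                     coordSlot (copy c j) d (pick d k) ≡ (map num (label c) [ i ]≔ num k) [ j ]≔ α
    coordSlot-copy c k j (yes t≡i) with trans (sym (type-copy c j)) t≡i
    ... | refl = trans (coord-copy c j) (sym ([]≔-idempotent (map num (label c)) j))
    coordSlot-copy c k j (no t≢i) = trans (cong (_[ i ]≔ num k) (coord-copy c j))
      ([]≔-commutes (map num (label c)) j i (λ j≡i → t≢i (trans (type-copy c j) j≡i)))

    coord′ : BookV q i G → Vec (Entry q) r
    coord′ (x , s) = coordSlot x (type x ≟ i) s

    coord′-countα : ∀ y → countα (coord′ y) ≡ 1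
    coord′-countα (x , s) = coordSlot-countα x (type x ≟ i) s

    vertexAt′ : Vqrα q r → BookV q i G
    vertexAt′ w = vertexAt w , pick (type (vertexAt w) ≟ i) (value (lookup (proj₁ w) i))

    vertexAt′-coord′ : ∀ y → vertexAt′ (coord′ y , coord′-countα y) ≡ y
    vertexAt′-coord′ (x , s) = begin
      vertexAt′ (coord′ (x , s) , coord′-countα (x , s))
        ≡⟨ cong (λ x′ → x′ , pick (type x′ ≟ i) (value (lookup (coord′ (x , s)) i)))
                (vertexAt-coordSlot x (type x ≟ i) s) ⟩
      x , pick (type x ≟ i) (value (lookup (coord′ (x , s)) i))
        ≡⟨ cong (x ,_) (pick-coordSlot x (type x ≟ i) s) ⟩
      x , s ∎
      where open ≡-Reasoning

    coordinates : Coordinates (D [ i ]≔ inside) (book q i G)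
    coordinates = record
      { coord          = coord′
      ; coord-countα   = coord′-countα
      ; coord-type     = λ { (x , s) → coordSlot-type x (type x ≟ i) s }
      ; vertexAt       = vertexAt′
      ; vertexAt-coord = vertexAt′-coord′
      ; coord-vertexAt = λ w → trans (coordSlot-pick w (vertexAt w) (type (vertexAt w) ≟ i) refl)
                                     (sym (zipWith-[]≔ˡ forgetₑ D (proj₁ w) i inside))
      ; label          = λ { (c , k) → label c [ i ]≔ k }
      ; copyAt         = λ e → copyAt e , lookup e i
      ; copyAt-label   = λ { (c , k) → cong₂ _,_
                               (trans (copyAt-restrict (restrict-[]≔-outside D (label c) k Dᵢ))
                                      (copyAt-label c))
                               (lookup∘update i (label c) k) }
      ; label-copyAt   = λ e → trans (cong (_[ i ]≔ lookup e i) (label-copyAt e))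
                                     (sym (zipWith-[]≔ˡ forget D e i inside))
      ; coord-copy     = λ { (c , k) j → trans (coordSlot-copy c k j (type (copy c j) ≟ i))
                                               (cong (_[ j ]≔ α) (sym (map-[]≔ num (label c) i))) }
      }

  coordinates₀ : (H : Graph r) → Coordinates ⊥ (H₀ H)
  coordinates₀ {r} H = record
    { coord          = unit
    ; coord-countα   = unit-countα
    ; coord-type     = unit-α
    ; vertexAt       = λ { (v , c) → αIndex v c }
    ; vertexAt-coord = λ t → α-unique (unit t) (unit-countα t) (lookup-αIndex (unit t) _) (unit-α t)
    ; coord-vertexAt = λ { (v , c) → sym (restrictₑ-⊥ v c) }
    ; label          = λ _ → replicate r o
    ; copyAt         = λ _ → tt
    ; copyAt-label   = λ _ → refl
    ; label-copyAt   = λ e → sym (restrict-⊥ e)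
    ; coord-copy     = λ _ _ → refl
    }
    where
    unit : Fin r → Vec (Entry q) r
    unit t = map num (replicate r o) [ t ]≔ α
    unit-countα : ∀ t → countα (unit t) ≡ 1
    unit-countα = countα-map-num-[]≔α (replicate r o)
    unit-α : ∀ t → lookup (unit t) t ≡ α
    unit-α t = lookup∘update t (map num (replicate r o)) α

  coordinates-foldl : ∀ {D : Subset r} {G} xs → Coordinates D G →
                      Unique xs → All (λ x → lookup D x ≡ outside) xs →
                      Coordinates (insertAll D xs) (foldl (λ G i → book q i G) G xs)
  coordinates-foldl []       C _                  _           = C
  coordinates-foldl {D = D} (x ∷ xs) C (x∉xs ∷ xs-unique) (Dₓ ∷ Dxs) =
    coordinates-foldl xs (BookStep.coordinates x C Dₓ) xs-unique
      (All.zipWith (λ { (x≢y , Dy) → trans (lookup∘update′ (≢-sym x≢y) D inside) Dy }) (x∉xs , Dxs))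

  standardCopies-≅-𝓗 : {G : TGraph r} → Coordinates ⊤ G → standardCopies G ≅ 𝓗 q r
  standardCopies-≅-𝓗 {r} {G} C = record
    { φ   = mk↔ₛ′ point vertexAt
                  (λ w → Vqrα-≡ (trans (coord-vertexAt w) (restrictₑ-⊤ (proj₁ w))))
                  vertexAt-coord
    ; fwd = λ c → label c , members c refl
    ; bwd = λ e → copyAt e , members (copyAt e) (trans (label-copyAt e) (restrict-⊤ e))
    }
    where
    open TGraph G
    open Coordinates C
    point : V → Vqrα q r
    point x = coord x , coord-countα x
    members : ∀ c {e} → label c ≡ e → ∀ x →
              (∃ λ j → copy c j ≡ x) ⇔ (∃ λ j → coord x ≡ map num e [ j ]≔ α)
    members c refl x = mk⇔ (λ { (j , refl) → j , coord-copy c j })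
                           (λ { (j , eq) → j , coord-injective (trans (coord-copy c j) (sym eq)) })

proposition4 : ∀ (r : ℕ) (H : Graph r) (q : ℕ) → 1 ≤ q →
    copyHypergraph H q ≅ 𝓗 q r
proposition4 r H (ℕ.suc q) (s≤s _) = standardCopies-≅-𝓗 zero
  (subst (λ D → Coordinates zero D (bookpile H (ℕ.suc q))) (insertAll-allFin ⊥)
    (coordinates-foldl zero (allFin r) (coordinates₀ zero H) (allFin⁺ r)
      (All.tabulate λ {x} _ → lookup-replicate x outside)))
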